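{- Let $F$ be a graph and $t\ge1$ an integer. There is a constant $C$ (depending on $F$ and $t$) such that for every $n$, if $\mathcal{H}$ is a hypergraph on $n$ vertices that contains no $t$-wise Berge copy of $F$ and every hyperedge of $\mathcal{H}$ has size at least $|V(F)|$, then $\sum_{H\in \mathcal{H}}|H|^2\le Cn^2$.
   Context: A hypergraph consists of a finite vertex set and a set of distinct subsets of it (hyperedges), not necessarily of equal size. For an integer $t\ge1$ and a graph $F$, a hypergraph $\mathcal{F}$ is a $t$-wise Berge copy of $F$ if $|E(\mathcal{F})|=t|E(F)|$ and there exist an injection $i:V(F)\to V(\mathcal{F})$ and a map $h$ assigning to each edge $e$ of $F$ a set $h(e)$ of $t$ hyperedges of $\mathcal{F}$ such that $h(e)\cap h(e')=\emptyset$ for distinct edges $e,e'$, and for every edge $e=xy$ of $F$, $\{i(x),i(y)\}\subseteq A$ for all $A\in h(e)$. Containment means as a subhypergraph. -}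

module Defs where

open import Data.Nat using (ℕ; _*_; _^_; _≤_)
open import Data.Fin using (Fin)
open import Data.Fin.Subset using (Subset; _∈_; ∣_∣)
open import Data.Product using (Σ; _×_; _,_; ∃-syntax; proj₁; proj₂)
open import Data.List using (tabulate)
open import Data.Nat.ListAction using (sum)
open import Relation.Binary.PropositionalEquality using (_≡_; _≢_)
open import Function.Definitions using (Injective)

-- A (finite, simple) graph: vertex set Fin vsize, edge set indexed by Fin esize;
-- edge j = (x , y) with x ≢ y, and distinct indices give distinct unordered pairs.
record Graph : Set where
  field
    vsize : ℕ
    esize : ℕ
    edge  : Fin esize → Fin vsize × Fin vsize
    loopless : ∀ j → proj₁ (edge j) ≢ proj₂ (edge j)
    distinct : ∀ j j′ → j ≢ j′ →
      (edge j ≢ edge j′) × (edge j ≢ (proj₂ (edge j′) , proj₁ (edge j′)))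

record Hypergraph (n : ℕ) : Set where
  field
    size  : ℕ
    hedge : Fin size → Subset n
    hedge-injective : Injective _≡_ _≡_ hedge

open Graph
open Hypergraph

ContainsBerge : (t : ℕ) (F : Graph) (n : ℕ) (H : Hypergraph n) → Set
ContainsBerge t F n H =
  Σ (Fin (vsize F) → Fin n) λ i →
  Σ (Fin (esize F) → Fin t → Fin (size H)) λ h →
    ( Injective _≡_ _≡_ i
    × Injective _≡_ _≡_ (λ (p : Fin (esize F) × Fin t) → h (proj₁ p) (proj₂ p))
    × (∀ e s → (i (proj₁ (edge F e)) ∈ hedge H (h e s))
             × (i (proj₂ (edge F e)) ∈ hedge H (h e s))) )

sumSqSizes : {n : ℕ} → Hypergraph n → ℕ
sumSqSizes H = sum (tabulate (λ j → ∣ hedge H j ∣ ^ 2))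

module Submission where

-- Call a pair of vertices heavy if at least M = t·|E(F)| hyperedges contain both of
-- them, and light otherwise. A set of |V(F)| vertices that are pairwise heavy yields a
-- t-wise Berge copy of F: the t·|E(F)| required hyperedges can be chosen greedily, since
-- every pair offers at least t·|E(F)| candidates. So no hyperedge H contains a heavy
-- |V(F)|-clique, and a Turán-type induction on the clique size shows that such a set has
-- at least |H|²/c ordered light pairs. Summing over all hyperedges counts each light pair
-- (u, v) once per hyperedge containing it, i.e. fewer than M times, whence
-- Σ |H|² ≤ c · M · n².

open import Data.Bool using (Bool; true; false; _∧_; not; T)
open import Data.Bool.Properties using () renaming (_≟_ to _≟ᵇ_)
open import Data.Empty using (⊥-elim)
open import Data.Fin using (Fin; zero; suc; _≟_; combine; remQuot)
open import Data.Fin.Properties using (any?; remQuot-combine)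
open import Data.Fin.Subset using (Subset; ∣_∣; _∈_)
open import Data.List using (tabulate)
open import Data.Nat using (ℕ; zero; suc; _+_; _*_; _^_; _≤_; _<_; _≤?_; _<ᵇ_; z≤n; s≤s)
open import Data.Nat.ListAction using () renaming (sum to sumᴸ)
open import Data.Nat.Properties
  using (+-*-semiring; ≤-refl; ≤-trans; ≤-reflexive; ≤-pred; <⇒≤; <⇒≱; ≮⇒≥; ≰⇒>;
         1+n≰n; n≤1+n; m≤n⇒m≤1+n;
         m≤m+n; m≤n+m; m≤m*n; <⇒<ᵇ; <ᵇ⇒<; +-suc; +-identityʳ; *-identityʳ; *-comm; *-assoc;
         +-mono-≤; +-monoˡ-≤; +-monoʳ-≤; +-cancelʳ-≤; *-mono-≤; *-monoˡ-≤; *-monoʳ-≤;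
         module ≤-Reasoning)
open import Algebra.Properties.Semiring.Sum +-*-semiring
  using (sum-syntax; sum-cong-≗; sum-remove; sum-replicate-zero; ∑-comm; ∑-distrib-+;
         *-distribˡ-sum; *-distribʳ-sum)
open import Data.Nat.Tactic.RingSolver using (solve-∀)
open import Data.Product using (Σ; _×_; _,_; ∃; ∃-syntax; proj₁; proj₂)
open import Data.Unit using (tt)
open import Data.Vec using ([]; _∷_; lookup)
open import Data.Vec.Functional as Vector using ()
open import Data.Vec.Properties using (lookup⇒[]=)
open import Function using (_∘_)
open import Function.Definitions using (Injective)
open import Relation.Binary.PropositionalEquality
open import Relation.Nullary using (¬_; yes; no; does; ¬?; _×-dec_; contradiction)
open import Relation.Nullary.Decidable using (dec-true)

open import Defs

⟦_⟧ : Bool → ℕ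
⟦ true ⟧  = 1
⟦ false ⟧ = 0

⟦⟧-mono : ∀ {a b} → (a ≡ true → b ≡ true) → ⟦ a ⟧ ≤ ⟦ b ⟧
⟦⟧-mono {false} _   = z≤n
⟦⟧-mono {true}  a⇒b rewrite a⇒b refl = ≤-refl

⟦∧⟧≡* : ∀ a b → ⟦ a ∧ b ⟧ ≡ ⟦ a ⟧ * ⟦ b ⟧
⟦∧⟧≡* false b = refl
⟦∧⟧≡* true  b = sym (+-identityʳ ⟦ b ⟧)

∧≡true : ∀ {a b} → a ∧ b ≡ true → a ≡ true × b ≡ true
∧≡true {true} {true} _ = refl , refl

∑-mono-≤ : ∀ {n} {f g : Fin n → ℕ} → (∀ i → f i ≤ g i) → ∑[ i < n ] f i ≤ ∑[ i < n ] g i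
∑-mono-≤ {zero}  f≤g = z≤n
∑-mono-≤ {suc n} f≤g = +-mono-≤ (f≤g zero) (∑-mono-≤ (f≤g ∘ suc))

∑-const : ∀ n c → ∑[ i < n ] c ≡ n * c
∑-const zero    c = refl
∑-const (suc n) c = cong (c +_) (∑-const n c)

term≤∑ : ∀ {n} (f : Fin n → ℕ) i → f i ≤ ∑[ j < n ] f j
term≤∑ {suc n} f i = ≤-trans (m≤m+n (f i) _) (≤-reflexive (sym (sum-remove {i = i} f)))

∑-indicator-≟ : ∀ {n} (a : Fin n) → ∑[ x < n ] ⟦ does (x ≟ a) ⟧ ≡ 1
∑-indicator-≟ {suc n} zero    = cong suc (sum-replicate-zero n)
∑-indicator-≟ {suc n} (suc a) = ∑-indicator-≟ a

sum-tabulate : ∀ {n} (f : Fin n → ℕ) → sumᴸ (tabulate f) ≡ ∑[ i < n ] f i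
sum-tabulate {zero}  f = refl
sum-tabulate {suc n} f = cong (f zero +_) (sum-tabulate (f ∘ suc))

#_ : ∀ {n} → (Fin n → Bool) → ℕ
#_ {n} A = ∑[ u < n ] ⟦ A u ⟧

∣p∣≡#lookup : ∀ {n} (p : Subset n) → ∣ p ∣ ≡ # lookup p
∣p∣≡#lookup []          = refl
∣p∣≡#lookup (true  ∷ p) = cong suc (∣p∣≡#lookup p)
∣p∣≡#lookup (false ∷ p) = ∣p∣≡#lookup p

#-nonempty : ∀ {n} (A : Fin n → Bool) → 1 ≤ # A → ∃ λ u → A u ≡ true
#-nonempty {suc n} A 1≤#A with A zero in A0
... | true  = zero , A0
... | false = let u , Au = #-nonempty (A ∘ suc) 1≤#A in suc u , Au

⊆image⇒#≤ : ∀ {N Q} (f : Fin Q → Fin N) (T : Fin N → Bool) →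
  (∀ x → T x ≡ true → ∃ λ i → f i ≡ x) → # T ≤ Q
⊆image⇒#≤ {N} {Q} f T T⊆image = begin
  ∑[ x < N ] ⟦ T x ⟧                        ≤⟨ ∑-mono-≤ hit ⟩
  ∑[ x < N ] ∑[ i < Q ] ⟦ does (x ≟ f i) ⟧  ≡⟨ ∑-comm (λ x i → ⟦ does (x ≟ f i) ⟧) ⟩
  ∑[ i < Q ] ∑[ x < N ] ⟦ does (x ≟ f i) ⟧  ≡⟨ sum-cong-≗ (∑-indicator-≟ ∘ f) ⟩
  ∑[ i < Q ] 1                              ≡⟨ ∑-const Q 1 ⟩
  Q * 1                                     ≡⟨ *-identityʳ Q ⟩
  Q                                         ∎
  where
  open ≤-Reasoning
  hit : ∀ x → ⟦ T x ⟧ ≤ ∑[ i < Q ] ⟦ does (x ≟ f i) ⟧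
  hit x with T x in x∈T
  ... | false = z≤n
  ... | true  with T⊆image x x∈T
  ...   | i , fi≡x = ≤-trans (≤-reflexive (cong ⟦_⟧ (sym (dec-true (x ≟ f i) (sym fi≡x)))))
                             (term≤∑ (λ i → ⟦ does (x ≟ f i) ⟧) i)

Representatives : ∀ {N Q} → (Fin Q → Fin N → Bool) → Set
Representatives {N} {Q} S = Σ (Fin Q → Fin N) λ f → Injective _≡_ _≡_ f × (∀ p → S p (f p) ≡ true)

distinct-representatives : ∀ {N Q} (S : Fin Q → Fin N → Bool) → (∀ p → Q ≤ # (S p)) →
  Representatives S
distinct-representatives {Q = zero}  S large = (λ ()) , (λ { {()} }) , λ ()
distinct-representatives {Q = suc Q} S large =
  extend (distinct-representatives (S ∘ suc) (λ p → ≤-trans (n≤1+n Q) (large (suc p))))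
  where
  extend : Representatives (S ∘ suc) → Representatives S
  extend (f , f-inj , f∈S) with any? (λ x → (S zero x ≟ᵇ true) ×-dec ¬? (any? λ i → f i ≟ x))
  ... | yes (x , x∈S , x-fresh) = x Vector.∷ f , inj , λ { zero → x∈S ; (suc p) → f∈S p }
    where
    inj : Injective _≡_ _≡_ (x Vector.∷ f)
    inj {zero}  {zero}  _  = refl
    inj {zero}  {suc j} eq = ⊥-elim (x-fresh (j , sym eq))
    inj {suc i} {zero}  eq = ⊥-elim (x-fresh (i , eq))
    inj {suc i} {suc j} eq = cong suc (f-inj eq)
  ... | no none-fresh = ⊥-elim (1+n≰n (≤-trans (large zero) (⊆image⇒#≤ f (S zero) S₀⊆image)))
    where
    S₀⊆image : ∀ x → S zero x ≡ true → ∃ λ i → f i ≡ x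
    S₀⊆image x x∈S with any? (λ i → f i ≟ x)
    ... | yes hit = hit
    ... | no miss = ⊥-elim (none-fresh (x , x∈S , miss))

combine-injective : ∀ {m k} {i i′ : Fin m} {j j′ : Fin k} →
  combine i j ≡ combine i′ j′ → (i , j) ≡ (i′ , j′)
combine-injective {k = k} {i} {i′} {j} {j′} eq =
  trans (sym (remQuot-combine i j)) (trans (cong (remQuot k) eq) (remQuot-combine i′ j′))

x*[y*z]≡y*[x*z] : ∀ x y z → x * (y * z) ≡ y * (x * z)
x*[y*z]≡y*[x*z] = solve-∀

x*[y*z]≡z*[x*y] : ∀ x y z → x * (y * z) ≡ z * (x * y)
x*[y*z]≡z*[x*y] = solve-∀

[x+x]*[x+x]≡4*[x*x] : ∀ x → (x + x) * (x + x) ≡ 4 * (x * x)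
[x+x]*[x+x]≡4*[x*x] = solve-∀

x*[y*[z*w]]≡x*w*[y*[z*1]] : ∀ x y z w → x * (y * (z * w)) ≡ x * w * (y * (z * 1))
x*[y*[z*w]]≡x*w*[y*[z*1]] = solve-∀

m≤[3+k]*d : ∀ {m d h} k → m ≤ suc (d + h) → h ≤ k → 2 + k ≤ m → m ≤ (3 + k) * d
m≤[3+k]*d {d = zero} k m≤1+h h≤k 2+k≤m = contradiction (≤-trans m≤1+h (s≤s h≤k)) (<⇒≱ 2+k≤m)
m≤[3+k]*d {m} {d@(suc _)} {h} k m≤1+d+h h≤k _ = begin
  m            ≤⟨ m≤1+d+h ⟩
  suc (d + h)  ≡⟨ +-suc d h ⟨
  d + suc h    ≤⟨ +-monoʳ-≤ d (≤-trans (s≤s (m≤n⇒m≤1+n h≤k)) (m≤m*n (2 + k) d)) ⟩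
  (3 + k) * d  ∎
  where open ≤-Reasoning

m≤3*d : ∀ {m d h} → m ≤ suc (d + h) → h + h < m → 2 ≤ m → m ≤ 3 * d
m≤3*d {m} {d} {h} m≤1+d+h 2h<m 2≤m =
  bound d m≤1+d+h (+-cancelʳ-≤ h h d (≤-pred (≤-trans 2h<m m≤1+d+h)))
  where
  bound : ∀ d → m ≤ suc (d + h) → h ≤ d → m ≤ 3 * d
  bound zero      m≤1+h   h≤0 = contradiction (≤-trans m≤1+h (s≤s h≤0)) (<⇒≱ 2≤m)
  bound d@(suc _) m≤1+d+h h≤d = begin
    m            ≤⟨ m≤1+d+h ⟩
    suc (d + h)  ≤⟨ s≤s (+-monoʳ-≤ d h≤d) ⟩
    1 + (d + d)  ≤⟨ +-monoˡ-≤ (d + d) (s≤s z≤n) ⟩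
    d + (d + d)  ≡⟨ cong (λ x → d + (d + x)) (+-identityʳ d) ⟨
    3 * d        ∎
    where open ≤-Reasoning

cliqueConstant : ℕ → ℕ
cliqueConstant zero    = 0
cliqueConstant (suc k) = 4 * cliqueConstant k + (2 + k)

codegree : ∀ {s n} → (Fin s → Fin n → Bool) → Fin n → Fin n → ℕ
codegree {s} A u v = ∑[ j < s ] (⟦ A j u ⟧ * ⟦ A j v ⟧)

module LightPairs {n} (light : Fin n → Fin n → Bool) (light-sym : ∀ u v → light u v ≡ light v u) where

  lightDegree : (Fin n → Bool) → Fin n → ℕ
  lightDegree A v = ∑[ u < n ] (⟦ A u ⟧ * ⟦ light v u ⟧)

  lightPairs : (Fin n → Bool) → ℕ
  lightPairs A = ∑[ v < n ] (⟦ A v ⟧ * lightDegree A v)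

  heavyNeighbours : (Fin n → Bool) → Fin n → Fin n → Bool
  heavyNeighbours A v u = A u ∧ not (does (u ≟ v)) ∧ not (light v u)

  heavyDegree : (Fin n → Bool) → Fin n → ℕ
  heavyDegree A v = # heavyNeighbours A v

  HeavyClique : ℕ → (Fin n → Bool) → Set
  HeavyClique k A = Σ (Fin k → Fin n) λ g → Injective _≡_ _≡_ g × (∀ a → A (g a) ≡ true)
                      × (∀ a b → a ≢ b → light (g a) (g b) ≡ false)

  emptyHeavyClique : ∀ A → HeavyClique 0 A
  emptyHeavyClique _ = (λ ()) , (λ { {()} }) , (λ ()) , λ ()

  HeavyClique-extend : ∀ {k} A {v} → A v ≡ true → HeavyClique k (heavyNeighbours A v) →
    HeavyClique (suc k) A
  HeavyClique-extend {k} A {v} v∈A (g , g-inj , g∈N , g-heavy) = v Vector.∷ g , inj , ∈A , heavy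
    where
    neighbour : ∀ a → A (g a) ≡ true × g a ≢ v × light v (g a) ≡ false
    neighbour a with A (g a) | g a ≟ v | light v (g a) | g∈N a
    ... | true | no ga≢v | false | _ = refl , ga≢v , refl
    inj : Injective _≡_ _≡_ (v Vector.∷ g)
    inj {zero}  {zero}  _  = refl
    inj {zero}  {suc b} eq = ⊥-elim (proj₁ (proj₂ (neighbour b)) (sym eq))
    inj {suc a} {zero}  eq = ⊥-elim (proj₁ (proj₂ (neighbour a)) eq)
    inj {suc a} {suc b} eq = cong suc (g-inj eq)
    ∈A : ∀ a → A ((v Vector.∷ g) a) ≡ true
    ∈A zero    = v∈A
    ∈A (suc a) = proj₁ (neighbour a)
    heavy : ∀ a b → a ≢ b → light ((v Vector.∷ g) a) ((v Vector.∷ g) b) ≡ false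
    heavy zero    zero    a≢b = ⊥-elim (a≢b refl)
    heavy zero    (suc b) _   = proj₂ (proj₂ (neighbour b))
    heavy (suc a) zero    _   = trans (light-sym (g a) v) (proj₂ (proj₂ (neighbour a)))
    heavy (suc a) (suc b) a≢b = g-heavy a b (a≢b ∘ cong suc)

  lightPairs-mono : ∀ {A B} → (∀ u → B u ≡ true → A u ≡ true) → lightPairs B ≤ lightPairs A
  lightPairs-mono B⊆A = ∑-mono-≤ λ v → *-mono-≤ (⟦⟧-mono (B⊆A v))
                          (∑-mono-≤ λ u → *-monoˡ-≤ ⟦ light v u ⟧ (⟦⟧-mono (B⊆A u)))

  #≤1+lightDegree+heavyDegree : ∀ A v → # A ≤ suc (lightDegree A v + heavyDegree A v)
  #≤1+lightDegree+heavyDegree A v = begin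
    ∑[ u < n ] ⟦ A u ⟧                                        ≤⟨ ∑-mono-≤ split ⟩
    ∑[ u < n ] (at-v u + (light-at u + heavy-at u))           ≡⟨ ∑-distrib-+ at-v _ ⟩
    ∑[ u < n ] at-v u + ∑[ u < n ] (light-at u + heavy-at u)
      ≡⟨ cong₂ _+_ (∑-indicator-≟ v) (∑-distrib-+ light-at heavy-at) ⟩
    suc (lightDegree A v + heavyDegree A v)                   ∎
    where
    open ≤-Reasoning
    at-v light-at heavy-at : Fin n → ℕ
    at-v     u = ⟦ does (u ≟ v) ⟧
    light-at u = ⟦ A u ⟧ * ⟦ light v u ⟧
    heavy-at u = ⟦ heavyNeighbours A v u ⟧
    split : ∀ u → ⟦ A u ⟧ ≤ at-v u + (light-at u + heavy-at u)
    split u with A u | light v u | does (u ≟ v)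
    ... | false | _     | _     = z≤n
    ... | true  | _     | true  = s≤s z≤n
    ... | true  | true  | false = ≤-refl
    ... | true  | false | false = ≤-refl

  #*#≤d*lightPairs : ∀ {A} d → (∀ v → A v ≡ true → # A ≤ d * lightDegree A v) →
    # A * # A ≤ d * lightPairs A
  #*#≤d*lightPairs {A} d light-rich = begin
    # A * # A                                     ≡⟨ *-distribʳ-sum (# A) (λ v → ⟦ A v ⟧) ⟩
    ∑[ v < n ] (⟦ A v ⟧ * # A)                    ≤⟨ ∑-mono-≤ per-vertex ⟩
    ∑[ v < n ] (⟦ A v ⟧ * (d * lightDegree A v))
      ≡⟨ sum-cong-≗ (λ v → x*[y*z]≡y*[x*z] ⟦ A v ⟧ d (lightDegree A v)) ⟩
    ∑[ v < n ] (d * (⟦ A v ⟧ * lightDegree A v))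
      ≡⟨ *-distribˡ-sum d (λ v → ⟦ A v ⟧ * lightDegree A v) ⟨
    d * lightPairs A                              ∎
    where
    open ≤-Reasoning
    per-vertex : ∀ v → ⟦ A v ⟧ * # A ≤ ⟦ A v ⟧ * (d * lightDegree A v)
    per-vertex v with A v in v∈A
    ... | false = z≤n
    ... | true  = *-monoʳ-≤ 1 (light-rich v v∈A)

  LightPairsBound : ℕ → Set
  LightPairsBound k = ∀ {A} → ¬ HeavyClique k A → k ≤ # A → # A * # A ≤ cliqueConstant k * lightPairs A

  -- Either some v ∈ A has at least max (k + 1, |A| / 2) heavy neighbours, which contain no
  -- heavy (k + 1)-clique, so the induction hypothesis applies to them; or every v ∈ A has
  -- light degree at least |A| / (k + 3).
  lightPairsBound-step : ∀ k → LightPairsBound (suc k) → LightPairsBound (suc (suc k))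
  lightPairsBound-step k IH {A} ¬clique 2+k≤#A
    with any? (λ v → (A v ≟ᵇ true) ×-dec ((# A ≤? heavyDegree A v + heavyDegree A v)
                                          ×-dec (suc k ≤? heavyDegree A v)))
  ... | yes (v , v∈A , #A≤2h , 1+k≤h) = begin
    # A * # A                                     ≤⟨ *-mono-≤ #A≤2h #A≤2h ⟩
    (h + h) * (h + h)                             ≡⟨ [x+x]*[x+x]≡4*[x*x] h ⟩
    4 * (h * h)                                   ≤⟨ *-monoʳ-≤ 4 (IH N-clique-free 1+k≤h) ⟩
    4 * (c * lightPairs (heavyNeighbours A v))    ≤⟨ *-monoʳ-≤ 4 (*-monoʳ-≤ c (lightPairs-mono N⊆A)) ⟩
    4 * (c * lightPairs A)                        ≡⟨ *-assoc 4 c (lightPairs A) ⟨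
    4 * c * lightPairs A                          ≤⟨ *-monoˡ-≤ (lightPairs A) (m≤m+n (4 * c) (3 + k)) ⟩
    cliqueConstant (suc (suc k)) * lightPairs A   ∎
    where
    open ≤-Reasoning
    h = heavyDegree A v
    c = cliqueConstant (suc k)
    N-clique-free : ¬ HeavyClique (suc k) (heavyNeighbours A v)
    N-clique-free = ¬clique ∘ HeavyClique-extend A v∈A
    N⊆A : ∀ u → heavyNeighbours A v u ≡ true → A u ≡ true
    N⊆A u with A u
    ... | true  = λ _ → refl
    ... | false = λ ()
  ... | no no-dense-neighbourhood = begin
    # A * # A                                     ≤⟨ #*#≤d*lightPairs (3 + k) light-rich ⟩
    (3 + k) * lightPairs A
      ≤⟨ *-monoˡ-≤ (lightPairs A) (m≤n+m (3 + k) (4 * cliqueConstant (suc k))) ⟩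
    cliqueConstant (suc (suc k)) * lightPairs A   ∎
    where
    open ≤-Reasoning
    light-rich : ∀ v → A v ≡ true → # A ≤ (3 + k) * lightDegree A v
    light-rich v v∈A with suc k ≤? heavyDegree A v
    ... | no k≮h = m≤[3+k]*d {d = lightDegree A v} k (#≤1+lightDegree+heavyDegree A v)
                     (≤-pred (≰⇒> k≮h)) 2+k≤#A
    ... | yes k<h = ≤-trans (m≤3*d {d = lightDegree A v} (#≤1+lightDegree+heavyDegree A v)
                                (≰⇒> λ #A≤2h → no-dense-neighbourhood (v , v∈A , #A≤2h , k<h))
                                (≤-trans (s≤s (s≤s z≤n)) 2+k≤#A))
                            (*-monoˡ-≤ (lightDegree A v) (m≤m+n 3 k))

  lightPairsBound : ∀ k → LightPairsBound k
  lightPairsBound zero          {A} ¬clique _    = contradiction (emptyHeavyClique A) ¬clique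
  lightPairsBound (suc zero)    {A} ¬clique 1≤#A =
    let v , v∈A = #-nonempty A 1≤#A in
    contradiction (HeavyClique-extend A v∈A (emptyHeavyClique (heavyNeighbours A v))) ¬clique
  lightPairsBound (suc (suc k))                  = lightPairsBound-step k (lightPairsBound (suc k))

  ∑-lightPairs : ∀ {s} (A : Fin s → Fin n → Bool) →
    ∑[ j < s ] lightPairs (A j) ≡ ∑[ v < n ] ∑[ u < n ] (⟦ light v u ⟧ * codegree A v u)
  ∑-lightPairs {s} A = begin
    ∑[ j < s ] ∑[ v < n ] (⟦ A j v ⟧ * ∑[ u < n ] (⟦ A j u ⟧ * ⟦ light v u ⟧))
      ≡⟨ sum-cong-≗ (λ j → sum-cong-≗ λ v →
           *-distribˡ-sum ⟦ A j v ⟧ (λ u → ⟦ A j u ⟧ * ⟦ light v u ⟧)) ⟩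
    ∑[ j < s ] ∑[ v < n ] ∑[ u < n ] term j v u  ≡⟨ ∑-comm (λ j v → ∑[ u < n ] term j v u) ⟩
    ∑[ v < n ] ∑[ j < s ] ∑[ u < n ] term j v u
      ≡⟨ sum-cong-≗ (λ v → ∑-comm (λ j u → term j v u)) ⟩
    ∑[ v < n ] ∑[ u < n ] ∑[ j < s ] term j v u
      ≡⟨ sum-cong-≗ (λ v → sum-cong-≗ λ u → sum-cong-≗ λ j →
           x*[y*z]≡z*[x*y] ⟦ A j v ⟧ ⟦ A j u ⟧ ⟦ light v u ⟧) ⟩
    ∑[ v < n ] ∑[ u < n ] ∑[ j < s ] (⟦ light v u ⟧ * (⟦ A j v ⟧ * ⟦ A j u ⟧))
      ≡⟨ sum-cong-≗ (λ v → sum-cong-≗ λ u →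
           *-distribˡ-sum ⟦ light v u ⟧ (λ j → ⟦ A j v ⟧ * ⟦ A j u ⟧)) ⟨
    ∑[ v < n ] ∑[ u < n ] (⟦ light v u ⟧ * codegree A v u) ∎
    where
    open ≡-Reasoning
    term : Fin s → Fin n → Fin n → ℕ
    term j v u = ⟦ A j v ⟧ * (⟦ A j u ⟧ * ⟦ light v u ⟧)

module Codegrees (F : Graph) (t : ℕ) {n} (H : Hypergraph n) where

  M : ℕ
  M = Graph.esize F * t

  inEdge : Fin (Hypergraph.size H) → Fin n → Bool
  inEdge j = lookup (Hypergraph.hedge H j)

  light : Fin n → Fin n → Bool
  light u v = codegree inEdge u v <ᵇ M

  light-sym : ∀ u v → light u v ≡ light v u
  light-sym u v = cong (_<ᵇ M) (sum-cong-≗ λ j → *-comm ⟦ inEdge j u ⟧ ⟦ inEdge j v ⟧)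

  open LightPairs light light-sym public

  heavy⇒M≤codegree : ∀ {u v} → light u v ≡ false → M ≤ codegree inEdge u v
  heavy⇒M≤codegree heavy = ≮⇒≥ λ codegree<M → subst T heavy (<⇒<ᵇ codegree<M)

  light*codegree≤M : ∀ u v → ⟦ light u v ⟧ * codegree inEdge u v ≤ M
  light*codegree≤M u v with light u v in uv-light
  ... | true  = ≤-trans (≤-reflexive (+-identityʳ _)) (<⇒≤ (<ᵇ⇒< _ M (subst T (sym uv-light) tt)))
  ... | false = z≤n

  -- A slot p : Fin (|E(F)| · t) stands for the pair remQuot t p : Fin |E(F)| × Fin t.
  HeavyClique⇒ContainsBerge : ∀ {A} → HeavyClique (Graph.vsize F) A → ContainsBerge t F n H
  HeavyClique⇒ContainsBerge (g , g-inj , _ , g-heavy) = g , h , g-inj , h-inj , h-covers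
    where
    x y : Fin (Graph.esize F) → Fin n
    x e = g (proj₁ (Graph.edge F e))
    y e = g (proj₂ (Graph.edge F e))
    containsEnds : Fin (Graph.esize F) → Fin (Hypergraph.size H) → Bool
    containsEnds e j = inEdge j (x e) ∧ inEdge j (y e)
    slotEdge : Fin (Graph.esize F * t) → Fin (Graph.esize F)
    slotEdge p = proj₁ (remQuot t p)
    enough : ∀ p → M ≤ # (containsEnds (slotEdge p))
    enough p = ≤-trans (heavy⇒M≤codegree (g-heavy _ _ (Graph.loopless F (slotEdge p))))
                       (≤-reflexive (sum-cong-≗ λ j → sym (⟦∧⟧≡* (inEdge j _) (inEdge j _))))
    representatives : Representatives (containsEnds ∘ slotEdge)
    representatives = distinct-representatives (containsEnds ∘ slotEdge) enough
    h : Fin (Graph.esize F) → Fin t → Fin (Hypergraph.size H)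
    h e s = proj₁ representatives (combine e s)
    h-inj : Injective _≡_ _≡_ (λ (p : Fin (Graph.esize F) × Fin t) → h (proj₁ p) (proj₂ p))
    h-inj eq = combine-injective (proj₁ (proj₂ representatives) eq)
    h-covers : ∀ e s → (x e ∈ Hypergraph.hedge H (h e s)) × (y e ∈ Hypergraph.hedge H (h e s))
    h-covers e s
      with ∧≡true (subst (λ e′ → containsEnds e′ (h e s) ≡ true) (cong proj₁ (remQuot-combine e s))
                          (proj₂ (proj₂ representatives) (combine e s)))
    ... | x∈ , y∈ = lookup⇒[]= _ _ x∈ , lookup⇒[]= _ _ y∈

  ∑-lightPairs≤n*[n*M] : ∑[ j < Hypergraph.size H ] lightPairs (inEdge j) ≤ n * (n * M)
  ∑-lightPairs≤n*[n*M] = begin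
    ∑[ j < Hypergraph.size H ] lightPairs (inEdge j)             ≡⟨ ∑-lightPairs inEdge ⟩
    ∑[ v < n ] ∑[ u < n ] (⟦ light v u ⟧ * codegree inEdge v u)
      ≤⟨ ∑-mono-≤ (∑-mono-≤ ∘ light*codegree≤M) ⟩
    ∑[ v < n ] ∑[ u < n ] M                                      ≡⟨ sum-cong-≗ {n} (λ _ → ∑-const n M) ⟩
    ∑[ v < n ] (n * M)                                           ≡⟨ ∑-const n (n * M) ⟩
    n * (n * M)                                                  ∎
    where open ≤-Reasoning

  ∣hedge∣²≤c*lightPairs : ¬ ContainsBerge t F n H →
    (∀ j → Graph.vsize F ≤ ∣ Hypergraph.hedge H j ∣) →
    ∀ j → ∣ Hypergraph.hedge H j ∣ ^ 2 ≤ cliqueConstant (Graph.vsize F) * lightPairs (inEdge j)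
  ∣hedge∣²≤c*lightPairs no-copy large j
    rewrite ∣p∣≡#lookup (Hypergraph.hedge H j) | *-identityʳ (# inEdge j) =
    lightPairsBound (Graph.vsize F) (no-copy ∘ HeavyClique⇒ContainsBerge {inEdge j})
      (subst (Graph.vsize F ≤_) (∣p∣≡#lookup (Hypergraph.hedge H j)) (large j))

proposition4 : (F : Graph) (t : ℕ) → 1 ≤ t →
    ∃[ C ] ((n : ℕ) (H : Hypergraph n) →
      ¬ ContainsBerge t F n H →
      (∀ j → Graph.vsize F ≤ ∣ Hypergraph.hedge H j ∣) →
      sumSqSizes H ≤ C * n ^ 2)
proposition4 F t _ = cliqueConstant (Graph.vsize F) * (Graph.esize F * t) , bound
  where
  bound : (n : ℕ) (H : Hypergraph n) → ¬ ContainsBerge t F n H →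
    (∀ j → Graph.vsize F ≤ ∣ Hypergraph.hedge H j ∣) →
    sumSqSizes H ≤ cliqueConstant (Graph.vsize F) * (Graph.esize F * t) * n ^ 2
  bound n H no-copy large = begin
    sumSqSizes H                               ≡⟨ sum-tabulate (λ j → ∣ Hypergraph.hedge H j ∣ ^ 2) ⟩
    ∑[ j < s ] (∣ Hypergraph.hedge H j ∣ ^ 2)  ≤⟨ ∑-mono-≤ (∣hedge∣²≤c*lightPairs no-copy large) ⟩
    ∑[ j < s ] (c * lightPairs (inEdge j))     ≡⟨ *-distribˡ-sum c (lightPairs ∘ inEdge) ⟨
    c * ∑[ j < s ] lightPairs (inEdge j)       ≤⟨ *-monoʳ-≤ c ∑-lightPairs≤n*[n*M] ⟩
    c * (n * (n * M))                          ≡⟨ x*[y*[z*w]]≡x*w*[y*[z*1]] c n n M ⟩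
    c * M * n ^ 2                              ∎
    where
    open ≤-Reasoning
    open Codegrees F t H
    s = Hypergraph.size H
    c = cliqueConstant (Graph.vsize F)
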